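{- Let $k,\ell\ge 1$ be integers, let $G$ be a graph, and let $V_{\rm NT}\subseteq V(G)$. Let $L$ be a set of vertices of degree at least two in $G$ such that (i) $|L|\ge 2\lceil k/4\rceil\ell$, and (ii) $G$ has a spanning tree $T$ in which every vertex of $V_{\rm NT}$ is internal, $L$ is a subset of the set of leaves of $T$, and each vertex of $V_{\rm NT}$ is adjacent in $T$ to at least two vertices of $V(G)\setminus L$. Then $G$ has $\ell$ spanning trees $T_1,\dots,T_\ell$ that are pairwise $k$-diverse, and the vertices of $V_{\rm NT}$ are internal in each $T_i$. Moreover, if $T$ has $s$ leaves, then for each $i\in[\ell]$, $T_i$ has at least $s-\lceil k/4\rceil$ leaves.
   Context: Graphs are finite, simple and undirected. In a tree, vertices of degree one are leaves and the others are internal. Spanning trees $T_1,\dots,T_\ell$ of $G$ are pairwise $k$-diverse if $|E(T_i)\triangle E(T_j)|\ge k$ for all $i\ne j$. $[\ell]=\{1,\dots,\ell\}$. -}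

module Defs where

open import Data.Nat using (ℕ; zero; suc; _+_; _≤_; _<ᵇ_; _/_)
open import Data.Bool using (Bool; true; false; if_then_else_; _∧_; _xor_; not)
open import Data.Fin using (Fin; toℕ)
open import Data.Fin.Subset using (Subset; _∈_; _∉_)
open import Data.List using (List; []; _∷_; _++_; [_]; length; map; allFin)
open import Data.Nat.ListAction using (sum)
open import Data.List.Relation.Unary.Unique.Propositional using (Unique)
open import Data.Product using (Σ; ∃; _×_; _,_)
open import Relation.Binary.PropositionalEquality using (_≡_; _≢_)
open import Relation.Nullary using (¬_)

record Graph (n : ℕ) : Set where
  field
    adj   : Fin n → Fin n → Bool
    sym   : ∀ u v → adj u v ≡ adj v u
    irrefl : ∀ v → adj v v ≡ false
open Graph public

count : {n : ℕ} → (Fin n → Bool) → ℕ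
count {n} p = sum (map (λ i → if p i then 1 else 0) (allFin n))

degree : {n : ℕ} → Graph n → Fin n → ℕ
degree G v = count (adj G v)

IsLeaf : {n : ℕ} → Graph n → Fin n → Set
IsLeaf T v = degree T v ≡ 1

IsInternal : {n : ℕ} → Graph n → Fin n → Set
IsInternal T v = ¬ IsLeaf T v

isLeafᵇ : {n : ℕ} → Graph n → Fin n → Bool
isLeafᵇ T v with degree T v
... | 1 = true
... | _ = false

numLeaves : {n : ℕ} → Graph n → ℕ
numLeaves T = count (isLeafᵇ T)

_⊆G_ : {n : ℕ} → Graph n → Graph n → Set
H ⊆G G = ∀ u v → adj H u v ≡ true → adj G u v ≡ true

data Walk {n : ℕ} (H : Graph n) : Fin n → Fin n → Set where
  here : ∀ {u} → Walk H u u
  step : ∀ {u w v} → adj H u w ≡ true → Walk H w v → Walk H u v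

Connected : {n : ℕ} → Graph n → Set
Connected H = ∀ u v → Walk H u v

data Chain {n : ℕ} (H : Graph n) : List (Fin n) → Set where
  []  : Chain H []
  [-] : ∀ {x} → Chain H (x ∷ [])
  _∷_ : ∀ {x y xs} → adj H x y ≡ true → Chain H (y ∷ xs) → Chain H (x ∷ y ∷ xs)

HasCycle : {n : ℕ} → Graph n → Set
HasCycle H = Σ _ λ x → Σ (List _) λ xs →
  (2 ≤ length xs) × Unique (x ∷ xs) × Chain H (x ∷ xs ++ [ x ])

Acyclic : {n : ℕ} → Graph n → Set
Acyclic H = ¬ HasCycle H

IsTree : {n : ℕ} → Graph n → Set
IsTree H = Connected H × Acyclic H

IsSpanningTree : {n : ℕ} → Graph n → Graph n → Set
IsSpanningTree G T = (T ⊆G G) × IsTree T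

-- |E(A) △ E(B)|: number of unordered pairs {u,v} (counted once via u < v)
-- that are edges in exactly one of A, B
symDiffSize : {n : ℕ} → Graph n → Graph n → ℕ
symDiffSize {n} A B =
  sum (map (λ u → count (λ v → (toℕ u <ᵇ toℕ v) ∧ (adj A u v xor adj B u v))) (allFin n))

ceil4 : ℕ → ℕ
ceil4 k = (k + 3) / 4

-- For v ∈ L let parent v be its neighbour in T and newParent v ≠ parent v another neighbour of v in G.
-- Rehanging leaves of L one after another (replacing the edge v–parent v by v–newParent v) keeps a
-- spanning tree as long as no leaf is rehung onto a leaf rehung after it. This holds if the leaves
-- whose arc v → newParent v points to a larger index are rehung in decreasing order of index, and
-- the others in increasing order; one of these two classes has at least ⌈k/4⌉ℓ leaves. Cutting it
-- into ℓ blocks of ⌈k/4⌉ leaves, two blocks give trees differing in the 4⌈k/4⌉ ≥ k distinct edges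
-- v–parent v, v–newParent v of their leaves; a leaf of T is lost only if it is some newParent v,
-- and a vertex of VNT keeps its edges to vertices outside L.

module Submission where

open import Defs hiding (sym)

open import Data.Bool using (Bool; true; false; T; if_then_else_; _∧_; _∨_; not; _xor_)
open import Data.Bool.ListAction using (any)
open import Data.Bool.Properties
  using (T-≡; ∧-zeroʳ; ∨-zeroʳ; ∨-comm; ∧-distribˡ-∨; ¬-not) renaming (_≟_ to _≟ᵇ_)
open import Data.Empty using (⊥)
open import Data.Fin as F using (Fin; zero; suc; toℕ)
open import Data.Fin.Properties as F using (_≟_; any?; toℕ-injective)
open import Data.Fin.Subset using (Subset; _∈_; _∉_; ∣_∣)
open import Data.Fin.Subset.Properties using (_∈?_)
open import Data.List using (List; []; _∷_; _++_; [_]; length; map; allFin; filter; take; drop; reverse)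
open import Data.List.Base using (initLast; _∷ʳ′_)
open import Data.List.Membership.Propositional using () renaming (_∈_ to _∈ₗ_; _∉_ to _∉ₗ_)
open import Data.List.Membership.Propositional.Properties using (∈-∃++; ∈-++⁺ʳ; ∈-++⁻)
open import Data.List.Properties
  using (map-tabulate; map-cong; length-++; length-map; length-take; length-drop; length-reverse; ++-assoc; unfold-reverse)
import Data.List.Relation.Binary.Permutation.Setoid.Properties as Permutation
open import Data.List.Relation.Unary.All as All using (All; []; _∷_)
import Data.List.Relation.Unary.All.Properties as All
open import Data.List.Relation.Unary.AllPairs as AllPairs using (AllPairs; []; _∷_)
import Data.List.Relation.Unary.AllPairs.Properties as AllPairs
open import Data.List.Relation.Unary.Any as Any using (here; there)
import Data.List.Relation.Unary.Any.Properties as Any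
open import Data.List.Relation.Unary.Unique.Propositional using (Unique)
open import Data.Nat using (ℕ; zero; suc; _+_; _*_; _∸_; _≤_; _<_; _≤?_; _<ᵇ_; _%_; z≤n; s≤s; s≤s⁻¹)
open import Data.Nat.DivMod using (m≡m%n+[m/n]*n; m%n<n)
open import Data.Nat.ListAction using (sum)
open import Data.Nat.Properties
  using ( ≤-trans; ≤-reflexive; ≤-antisym; <-cmp; <-asym; <-irrefl; <⇒≤; ≰⇒>; <ᵇ⇒<; <⇒<ᵇ; 1+n≰n
        ; m≤n⇒m≤1+n; m≤m+n; m≤n⇒m⊓n≡m; m≤n+o⇒m∸n≤o; m+n∸n≡m; ∸-monoˡ-≤
        ; +-comm; +-assoc; +-suc; +-identityʳ; +-mono-≤; +-monoˡ-≤; +-monoʳ-≤; +-cancelˡ-≤; +-cancelʳ-≤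
        ; *-comm; *-assoc; *-suc; +-commutativeSemigroup; module ≤-Reasoning)
open import Algebra.Properties.CommutativeSemigroup +-commutativeSemigroup using (interchange)
open import Data.Product using (Σ; ∃-syntax; _×_; _,_; proj₁; proj₂; uncurry)
open import Data.Sum using (_⊎_; inj₁; inj₂)
open import Data.Vec as Vec using (lookup)
open import Data.Vec.Properties using ([]=⇒lookup)
open import Function using (_∘_; id; flip)
open import Function.Bundles using (Equivalence)
open import Relation.Binary.Definitions using (Symmetric; tri<; tri≈; tri>)
open import Relation.Binary.PropositionalEquality
  using (_≡_; _≢_; refl; sym; trans; cong; cong₂; subst; setoid; ≢-sym; module ≡-Reasoning)
open import Relation.Nullary using (¬_; Dec; yes; no; does; contradiction; ¬?)
open import Relation.Nullary.Decidable using (dec-true; dec-false; _→-dec_)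
open import Relation.Unary using (Decidable)

∧-elimˡ : {c d : Bool} → (c ∧ d) ≡ true → c ≡ true
∧-elimˡ {true} _ = refl

∧-elimʳ : {c d : Bool} → (c ∧ d) ≡ true → d ≡ true
∧-elimʳ {true} d≡true = d≡true

<⇒<ᵇ≡true : {m k : ℕ} → m < k → (m <ᵇ k) ≡ true
<⇒<ᵇ≡true m<k = Equivalence.to T-≡ (<⇒<ᵇ m<k)

<ᵇ≡true⇒< : {m k : ℕ} → (m <ᵇ k) ≡ true → m < k
<ᵇ≡true⇒< {m} {k} e = <ᵇ⇒< m k (Equivalence.from T-≡ e)

module _ {A : Set} where

  any-witness : (p : A → Bool) (xs : List A) → any p xs ≡ true → ∃[ x ] x ∈ₗ xs × p x ≡ true
  any-witness p (x ∷ xs) e with p x in px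
  ... | true  = x , here refl , px
  ... | false with any-witness p xs e
  ...   | y , y∈xs , py = y , there y∈xs , py

  any-intro : {p : A → Bool} {xs : List A} → Any.Any (λ x → p x ≡ true) xs → any p xs ≡ true
  any-intro (here px) rewrite px = refl
  any-intro {p} {y ∷ _} (there pxs) = trans (cong (p y ∨_) (any-intro pxs)) (∨-zeroʳ _)

  sum-map-mono : {f g : A → ℕ} → (∀ x → f x ≤ g x) → ∀ xs → sum (map f xs) ≤ sum (map g xs)
  sum-map-mono f≤g []       = z≤n
  sum-map-mono f≤g (x ∷ xs) = +-mono-≤ (f≤g x) (sum-map-mono f≤g xs)

  sum-map-+ : (f g : A → ℕ) → ∀ xs → sum (map (λ x → f x + g x) xs) ≡ sum (map f xs) + sum (map g xs)
  sum-map-+ f g []       = refl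
  sum-map-+ f g (x ∷ xs) =
    trans (cong (f x + g x +_) (sum-map-+ f g xs)) (interchange (f x) (g x) _ _)

  sum-map-zero : {f : A → ℕ} → (∀ x → f x ≡ 0) → ∀ xs → sum (map f xs) ≡ 0
  sum-map-zero f≡0 []       = refl
  sum-map-zero f≡0 (x ∷ xs) rewrite f≡0 x = sum-map-zero f≡0 xs

  tally : (A → Bool) → List A → ℕ
  tally f xs = sum (map (λ x → if f x then 1 else 0) xs)

  tally-mono : {f g : A → Bool} → (∀ x → f x ≡ true → g x ≡ true) → ∀ xs → tally f xs ≤ tally g xs
  tally-mono f⇒g [] = z≤n
  tally-mono {f} {g} f⇒g (x ∷ xs) with f x in fx | g x in gx
  ... | true  | true  = s≤s (tally-mono f⇒g xs)
  ... | true  | false = contradiction (trans (sym (f⇒g x fx)) gx) λ ()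
  ... | false | true  = m≤n⇒m≤1+n (tally-mono f⇒g xs)
  ... | false | false = tally-mono f⇒g xs

  tally-∨-∧ : ∀ f g xs → tally (λ x → f x ∨ g x) xs + tally (λ x → f x ∧ g x) xs ≡ tally f xs + tally g xs
  tally-∨-∧ f g [] = refl
  tally-∨-∧ f g (x ∷ xs) with f x | g x | tally-∨-∧ f g xs
  ... | true  | true  | ih = cong suc (trans (+-suc _ _) (trans (cong suc ih) (sym (+-suc _ _))))
  ... | true  | false | ih = cong suc ih
  ... | false | true  | ih = trans (cong suc ih) (sym (+-suc _ _))
  ... | false | false | ih = ih

  tally-false : {f : A → Bool} → (∀ x → f x ≡ false) → ∀ xs → tally f xs ≡ 0
  tally-false f≡false [] = refl
  tally-false f≡false (x ∷ xs) rewrite f≡false x = tally-false f≡false xs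

  tally-witness : {f : A → Bool} → ∀ xs → 1 ≤ tally f xs → ∃[ x ] f x ≡ true
  tally-witness {f} (x ∷ xs) pos with f x in fx
  ... | true  = x , fx
  ... | false = tally-witness xs pos

  module _ {P : A → Set} (P? : Decidable P) where

    length-filter≡tally : ∀ xs → length (filter P? xs) ≡ tally (does ∘ P?) xs
    length-filter≡tally [] = refl
    length-filter≡tally (x ∷ xs) with does (P? x)
    ... | true  = cong suc (length-filter≡tally xs)
    ... | false = length-filter≡tally xs

    length-filter-¬ : ∀ xs → length (filter P? xs) + length (filter (¬? ∘ P?) xs) ≡ length xs
    length-filter-¬ [] = refl
    length-filter-¬ (x ∷ xs) with does (P? x)
    ... | true  = cong suc (length-filter-¬ xs)
    ... | false = trans (+-suc _ _) (cong suc (length-filter-¬ xs))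

module _ {n : ℕ} where

  _≡ᵇ_ : Fin n → Fin n → Bool
  x ≡ᵇ y = does (x ≟ y)

  ≡ᵇ⇒≡ : {x y : Fin n} → x ≡ᵇ y ≡ true → x ≡ y
  ≡ᵇ⇒≡ {x} {y} eq with x ≟ y
  ... | yes x≡y = x≡y

  ≡ᵇ-refl : (x : Fin n) → x ≡ᵇ x ≡ true
  ≡ᵇ-refl x = dec-true (x ≟ x) refl

  ≢⇒≡ᵇ-false : {x y : Fin n} → x ≢ y → x ≡ᵇ y ≡ false
  ≢⇒≡ᵇ-false {x} {y} = dec-false (x ≟ y)

count-suc : {n : ℕ} (f : Fin (suc n) → Bool) → count f ≡ (if f zero then 1 else 0) + count (f ∘ suc)
count-suc {n} f =
  cong ((if f zero then 1 else 0) +_) (cong sum (trans (map-tabulate suc h) (sym (map-tabulate id (h ∘ suc)))))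
  where
  h : Fin (suc n) → ℕ
  h x = if f x then 1 else 0

count-≡ᵇ : {n : ℕ} (a : Fin n) → count (_≡ᵇ a) ≡ 1
count-≡ᵇ {suc n} zero =
  trans (count-suc {n} (_≡ᵇ zero)) (cong suc (tally-false {f = λ x → suc x ≡ᵇ zero} (λ _ → refl) (allFin n)))
count-≡ᵇ {suc n} (suc a) = trans (count-suc {n} (_≡ᵇ suc a)) (count-≡ᵇ a)

module _ {n : ℕ} where

  open ≤-Reasoning

  count-cong : {f g : Fin n → Bool} → (∀ x → f x ≡ g x) → count f ≡ count g
  count-cong f≗g = cong sum (map-cong (λ x → cong (λ b → if b then 1 else 0) (f≗g x)) (allFin n))

  count-mono : {f g : Fin n → Bool} → (∀ x → f x ≡ true → g x ≡ true) → count f ≤ count g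
  count-mono f⇒g = tally-mono f⇒g (allFin n)

  count-∨ : (f g : Fin n → Bool) → count (λ x → f x ∨ g x) ≤ count f + count g
  count-∨ f g = ≤-trans (m≤m+n _ _) (≤-reflexive (tally-∨-∧ f g (allFin n)))

  count-∨-disjoint : {f g : Fin n → Bool} → (∀ x → f x ≡ true → g x ≡ false) →
                     count (λ x → f x ∨ g x) ≡ count f + count g
  count-∨-disjoint {f} {g} disjoint = begin-equality
    count (λ x → f x ∨ g x)                            ≡⟨ +-identityʳ _ ⟨
    count (λ x → f x ∨ g x) + 0                        ≡⟨ cong (count (λ x → f x ∨ g x) +_)
                                                               (tally-false neither (allFin n)) ⟨
    count (λ x → f x ∨ g x) + count (λ x → f x ∧ g x)  ≡⟨ tally-∨-∧ f g (allFin n) ⟩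
    count f + count g                                  ∎
    where
    neither : ∀ x → (f x ∧ g x) ≡ false
    neither x with f x in fx
    ... | true  = disjoint x fx
    ... | false = refl

  count-positive : {f : Fin n → Bool} {a : Fin n} → f a ≡ true → 1 ≤ count f
  count-positive {f} {a} fa = begin
    1              ≡⟨ count-≡ᵇ a ⟨
    count (_≡ᵇ a)  ≤⟨ count-mono (λ x x≡a → subst (λ y → f y ≡ true) (sym (≡ᵇ⇒≡ x≡a)) fa) ⟩
    count f        ∎

  count-single : {f : Fin n → Bool} {a : Fin n} → f a ≡ true → (∀ y → f y ≡ true → y ≡ a) → count f ≡ 1
  count-single {f} {a} fa only-a = ≤-antisym at-most-one (count-positive fa)
    where
    at-most-one : count f ≤ 1
    at-most-one = begin
      count f        ≤⟨ count-mono (λ y fy → dec-true (y ≟ a) (only-a y fy)) ⟩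
      count (_≡ᵇ a)  ≡⟨ count-≡ᵇ a ⟩
      1              ∎

  count≤1⇒unique : {f : Fin n → Bool} → count f ≤ 1 → {a b : Fin n} → f a ≡ true → f b ≡ true → a ≡ b
  count≤1⇒unique {f} f≤1 {a} {b} fa fb with a ≟ b
  ... | yes a≡b = a≡b
  ... | no a≢b = contradiction (≤-trans two≤f f≤1) (1+n≰n {1})
    where
    not-b : ∀ x → x ≡ᵇ a ≡ true → x ≡ᵇ b ≡ false
    not-b x x≡a = ≢⇒≡ᵇ-false (a≢b ∘ trans (sym (≡ᵇ⇒≡ {x = x} {y = a} x≡a)))
    at-a-or-b : ∀ x → (x ≡ᵇ a ∨ x ≡ᵇ b) ≡ true → f x ≡ true
    at-a-or-b x _ with x ≟ a | x ≟ b
    at-a-or-b x () | no _ | no _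
    ... | yes refl | _ = fa
    ... | no _ | yes refl = fb
    two≤f : 2 ≤ count f
    two≤f = begin
      2                               ≡⟨ cong₂ _+_ (count-≡ᵇ a) (count-≡ᵇ b) ⟨
      count (_≡ᵇ a) + count (_≡ᵇ b)   ≡⟨ count-∨-disjoint not-b ⟨
      count (λ x → x ≡ᵇ a ∨ x ≡ᵇ b)   ≤⟨ count-mono at-a-or-b ⟩
      count f                         ∎

  count≥2⇒other : {f : Fin n → Bool} → 2 ≤ count f → (a : Fin n) → ∃[ x ] f x ≡ true × x ≢ a
  count≥2⇒other {f} 2≤f a = witness (tally-witness (allFin n) off-a-positive)
    where
    off-a : Fin n → Bool
    off-a x = f x ∧ not (x ≡ᵇ a)
    split : ∀ x → f x ≡ true → (off-a x ∨ x ≡ᵇ a) ≡ true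
    split x fx with x ≟ a
    ... | yes _ = ∨-zeroʳ _
    ... | no _ rewrite fx = refl
    off-a-positive : 1 ≤ count off-a
    off-a-positive = +-cancelʳ-≤ 1 1 (count off-a) (begin
      2                                ≤⟨ 2≤f ⟩
      count f                          ≤⟨ count-mono {g = λ x → off-a x ∨ x ≡ᵇ a} split ⟩
      count (λ x → off-a x ∨ x ≡ᵇ a)   ≤⟨ count-∨ off-a (_≡ᵇ a) ⟩
      count off-a + count (_≡ᵇ a)      ≡⟨ cong (count off-a +_) (count-≡ᵇ a) ⟩
      count off-a + 1                  ∎)
    witness : ∃[ x ] off-a x ≡ true → ∃[ x ] f x ≡ true × x ≢ a
    witness (x , e) with f x in fx | x ≟ a | e
    ... | true | no x≢a | _ = x , fx , x≢a

  count-image : {B : Set} (g : B → Fin n) (S : List B) → count (λ x → any (λ v → x ≡ᵇ g v) S) ≤ length S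
  count-image g [] = ≤-reflexive (tally-false (λ _ → refl) (allFin n))
  count-image g (v ∷ S) = begin
    count (λ x → x ≡ᵇ g v ∨ any (λ v → x ≡ᵇ g v) S)        ≤⟨ count-∨ _ _ ⟩
    count (_≡ᵇ g v) + count (λ x → any (λ v → x ≡ᵇ g v) S) ≤⟨ +-mono-≤ (≤-reflexive (count-≡ᵇ (g v)))
                                                                        (count-image g S) ⟩
    1 + length S                                           ∎

  choose : (Fin n → Bool) → Fin n → Fin n
  choose f d with any? (λ x → f x ≟ᵇ true)
  ... | yes (x , _) = x
  ... | no _        = d

  choose-spec : (f : Fin n → Bool) (d : Fin n) → 1 ≤ count f → f (choose f d) ≡ true
  choose-spec f d pos with any? (λ x → f x ≟ᵇ true)
  ... | yes (_ , fx) = fx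
  ... | no ∄x        = contradiction (tally-witness (allFin n) pos) ∄x

adj-sym : {n : ℕ} (H : Graph n) {x y : Fin n} → adj H x y ≡ true → adj H y x ≡ true
adj-sym H {x} {y} = trans (Graph.sym H y x)

module _ {n : ℕ} {H : Graph n} where

  walk-snoc : {a b c : Fin n} → Walk H a b → adj H b c ≡ true → Walk H a c
  walk-snoc here        e = step e here
  walk-snoc (step e′ w) e = step e′ (walk-snoc w e)

  walk-within-edge : {u v : Fin n} → (∀ y → adj H u y ≡ true → y ≡ v) → (∀ y → adj H v y ≡ true → y ≡ u) →
                     {a z : Fin n} → Walk H a z → a ≡ u ⊎ a ≡ v → z ≡ u ⊎ z ≡ v
  walk-within-edge u→v v→u here         a∈uv        = a∈uv
  walk-within-edge u→v v→u (step e walk) (inj₁ refl) = walk-within-edge u→v v→u walk (inj₂ (u→v _ e))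
  walk-within-edge u→v v→u (step e walk) (inj₂ refl) = walk-within-edge u→v v→u walk (inj₁ (v→u _ e))

  chain-split : ∀ as {b cs} → Chain H (as ++ b ∷ cs) → Chain H (as ++ [ b ]) × Chain H (b ∷ cs)
  chain-split []           ch       = [-] , ch
  chain-split (a ∷ [])     (e ∷ ch) = e ∷ [-] , ch
  chain-split (a ∷ a′ ∷ as) (e ∷ ch) with chain-split (a′ ∷ as) ch
  ... | front , back = e ∷ front , back

  chain-join : ∀ as {b cs} → Chain H (as ++ [ b ]) → Chain H (b ∷ cs) → Chain H (as ++ b ∷ cs)
  chain-join []            _              back = back
  chain-join (a ∷ [])      (e ∷ [-])      back = e ∷ back
  chain-join (a ∷ a′ ∷ as) (e ∷ front)    back = e ∷ chain-join (a′ ∷ as) front back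

CycleAt : {n : ℕ} → Graph n → Fin n → List (Fin n) → Set
CycleAt H x xs = 2 ≤ length xs × Unique (x ∷ xs) × Chain H (x ∷ xs ++ [ x ])

module _ {n : ℕ} {H : Graph n} where

  cycle-rotate : ∀ {x u} pre post → CycleAt H x (pre ++ u ∷ post) → CycleAt H u (post ++ x ∷ pre)
  cycle-rotate {x} {u} pre post (long , distinct , closed) =
    subst (2 ≤_) length-rotate long ,
    Permutation.Unique-resp-↭ (setoid (Fin n)) (Permutation.++-comm (setoid (Fin n)) (x ∷ pre) (u ∷ post)) distinct ,
    subst (Chain H ∘ (u ∷_)) (sym (++-assoc post (x ∷ pre) [ u ])) (chain-join (u ∷ post) (proj₂ arcs) (proj₁ arcs))
    where
    arcs : Chain H (x ∷ pre ++ [ u ]) × Chain H (u ∷ post ++ [ x ])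
    arcs = chain-split (x ∷ pre) (subst (Chain H ∘ (x ∷_)) (++-assoc pre (u ∷ post) [ x ]) closed)
    length-rotate : length (pre ++ u ∷ post) ≡ length (post ++ x ∷ pre)
    length-rotate = begin
      length (pre ++ u ∷ post)        ≡⟨ length-++ pre ⟩
      length pre + suc (length post)  ≡⟨ +-suc (length pre) _ ⟩
      suc (length pre + length post)  ≡⟨ cong suc (+-comm (length pre) _) ⟩
      suc (length post + length pre)  ≡⟨ +-suc (length post) _ ⟨
      length post + suc (length pre)  ≡⟨ length-++ post ⟨
      length (post ++ x ∷ pre)        ∎
      where open ≡-Reasoning

  TwoNeighbours : Fin n → Set
  TwoNeighbours u = ∃[ b ] ∃[ c ] b ≢ c × adj H u b ≡ true × adj H u c ≡ true

  cycle-base⇒two-neighbours : ∀ {u xs} → CycleAt H u xs → TwoNeighbours u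
  cycle-base⇒two-neighbours {xs = []} (() , _)
  cycle-base⇒two-neighbours {u} {b ∷ ys} (long , distinct , closed) with initLast ys | long | distinct | closed
  ... | [] | s≤s () | _ | _
  ... | zs ∷ʳ′ c | _ | _ ∷ b∉ | e ∷ closed′ =
    b , c , All.lookup (AllPairs.head b∉) (∈-++⁺ʳ zs {[ c ]} (here refl)) , e , adj-sym H (last-edge (proj₂ arc))
    where
    arc = chain-split (u ∷ b ∷ zs) (subst (Chain H ∘ (u ∷_) ∘ (b ∷_)) (++-assoc zs [ c ] [ u ]) (e ∷ closed′))
    last-edge : Chain H (c ∷ u ∷ []) → adj H c u ≡ true
    last-edge (e′ ∷ [-]) = e′

  on-cycle⇒two-neighbours : ∀ {x xs u} → CycleAt H x xs → u ∈ₗ x ∷ xs → TwoNeighbours u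
  on-cycle⇒two-neighbours cycle (here refl) = cycle-base⇒two-neighbours cycle
  on-cycle⇒two-neighbours cycle (there u∈xs) with ∈-∃++ u∈xs
  ... | pre , post , refl = cycle-base⇒two-neighbours (cycle-rotate pre post cycle)

module _ {n : ℕ} where

  rehang : Graph n → Fin n → Fin n → Graph n
  rehang H u v = record { adj = adjʳ ; sym = adjʳ-sym ; irrefl = adjʳ-irrefl }
    where
    adjʳ : Fin n → Fin n → Bool
    adjʳ x y = if x ≡ᵇ u then (if y ≡ᵇ u then false else y ≡ᵇ v)
               else (if y ≡ᵇ u then x ≡ᵇ v else adj H x y)
    adjʳ-sym : ∀ x y → adjʳ x y ≡ adjʳ y x
    adjʳ-sym x y with x ≟ u | y ≟ u
    ... | yes _ | yes _ = refl
    ... | yes _ | no _  = refl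
    ... | no _  | yes _ = refl
    ... | no _  | no _  = Graph.sym H x y
    adjʳ-irrefl : ∀ x → adjʳ x x ≡ false
    adjʳ-irrefl x with x ≟ u
    ... | yes _ = refl
    ... | no _  = Graph.irrefl H x

  module _ {H : Graph n} {u v : Fin n} where

    rehang-away : {x y : Fin n} → x ≢ u → y ≢ u → adj (rehang H u v) x y ≡ adj H x y
    rehang-away {x} {y} x≢u y≢u with x ≟ u | y ≟ u
    ... | yes x≡u | _       = contradiction x≡u x≢u
    ... | no _    | yes y≡u = contradiction y≡u y≢u
    ... | no _    | no _    = refl

    rehang-new-edge : v ≢ u → adj (rehang H u v) u v ≡ true
    rehang-new-edge v≢u with u ≟ u | v ≟ u | v ≟ v
    ... | no u≢u | _       | _      = contradiction refl u≢u
    ... | yes _  | yes v≡u | _      = contradiction v≡u v≢u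
    ... | yes _  | no _    | yes _  = refl
    ... | yes _  | no _    | no v≢v = contradiction refl v≢v

    rehang-edge : {x y : Fin n} → adj (rehang H u v) x y ≡ true →
                  (x ≢ u × y ≢ u × adj H x y ≡ true) ⊎ (x ≡ u × y ≡ v) ⊎ (y ≡ u × x ≡ v)
    rehang-edge {x} {y} e with x ≟ u | y ≟ u | e
    ... | yes _   | yes _   | ()
    ... | yes x≡u | no _    | y≡ᵇv = inj₂ (inj₁ (x≡u , ≡ᵇ⇒≡ y≡ᵇv))
    ... | no _    | yes y≡u | x≡ᵇv = inj₂ (inj₂ (y≡u , ≡ᵇ⇒≡ x≡ᵇv))
    ... | no x≢u  | no y≢u  | xy   = inj₁ (x≢u , y≢u , xy)

    rehang-leaf : ∀ y → adj (rehang H u v) u y ≡ true → y ≡ v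
    rehang-leaf y e with rehang-edge e
    ... | inj₁ (u≢u , _)         = contradiction refl u≢u
    ... | inj₂ (inj₁ (_ , y≡v))   = y≡v
    ... | inj₂ (inj₂ (y≡u , u≡v)) = trans y≡u u≡v

    chain-avoiding : ∀ {l} → All (u ≢_) l → Chain (rehang H u v) l → Chain H l
    chain-avoiding _                  []       = []
    chain-avoiding _                  [-]      = [-]
    chain-avoiding (u≢x ∷ u≢y ∷ away) (e ∷ ch) =
      trans (sym (rehang-away (≢-sym u≢x) (≢-sym u≢y))) e ∷ chain-avoiding (u≢y ∷ away) ch

    module _ {p : Fin n} (v≢u : v ≢ u) (u→p : ∀ y → adj H u y ≡ true → y ≡ p) where

      -- a walk of H entering u must leave it again through p, so the visit can be cut out
      reroute : ∀ {a b} → Walk H a b → a ≢ u → b ≢ u → Walk (rehang H u v) a b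
      reroute here _ _ = here
      reroute {a} (step {w = z} e rest) a≢u b≢u with z ≟ u
      ... | no z≢u = step (trans (rehang-away a≢u z≢u) e) (reroute rest z≢u b≢u)
      reroute (step e here) a≢u b≢u | yes refl = contradiction refl b≢u
      reroute {a} (step e (step {w = z′} e′ rest)) a≢u b≢u | yes refl
        with trans (u→p z′ e′) (sym (u→p a (adj-sym H e)))
      ... | refl = reroute rest a≢u b≢u

      rehang-connected : Connected H → Connected (rehang H u v)
      rehang-connected connected a b with a ≟ u | b ≟ u
      ... | yes refl | yes refl = here
      ... | yes refl | no b≢u   = step (rehang-new-edge v≢u) (reroute (connected v b) v≢u b≢u)
      ... | no a≢u   | yes refl =
        walk-snoc (reroute (connected a v) a≢u v≢u) (adj-sym (rehang H u v) {u} {v} (rehang-new-edge v≢u))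
      ... | no a≢u   | no b≢u   = reroute (connected a b) a≢u b≢u

      rehang-acyclic : Acyclic H → Acyclic (rehang H u v)
      rehang-acyclic acyclic (x , xs , cycle@(long , distinct , closed)) with Any.any? (u ≟_) (x ∷ xs)
      ... | yes u∈cycle = u-has-one-neighbour (on-cycle⇒two-neighbours cycle u∈cycle)
        where
        u-has-one-neighbour : ¬ TwoNeighbours {H = rehang H u v} u
        u-has-one-neighbour (b , c , b≢c , ub , uc) = b≢c (trans (rehang-leaf b ub) (sym (rehang-leaf c uc)))
      ... | no u∉cycle = acyclic (x , xs , long , distinct , chain-avoiding avoids closed)
        where
        away : All (u ≢_) (x ∷ xs)
        away = All.¬Any⇒All¬ (x ∷ xs) u∉cycle
        avoids : All (u ≢_) (x ∷ xs ++ [ x ])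
        avoids = All.++⁺ away (All.head away ∷ [])

      rehang-isTree : IsTree H → IsTree (rehang H u v)
      rehang-isTree (connected , acyclic) = rehang-connected connected , rehang-acyclic acyclic

module _ {n : ℕ} where

  edgeCount : (Fin n → Fin n → Bool) → ℕ
  edgeCount E = sum (map (λ x → count (λ y → (toℕ x <ᵇ toℕ y) ∧ E x y)) (allFin n))

  edgeCount-cong : {E F : Fin n → Fin n → Bool} → (∀ x y → E x y ≡ F x y) → edgeCount E ≡ edgeCount F
  edgeCount-cong E≗F =
    cong sum (map-cong (λ x → count-cong (λ y → cong ((toℕ x <ᵇ toℕ y) ∧_) (E≗F x y))) (allFin n))

  edgeCount-mono : {E F : Fin n → Fin n → Bool} → (∀ x y → E x y ≡ true → F x y ≡ true) →
                   edgeCount E ≤ edgeCount F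
  edgeCount-mono E⇒F = sum-map-mono (λ x → count-mono (λ y → guarded (E⇒F x y))) (allFin n)
    where
    guarded : {c d e : Bool} → (d ≡ true → e ≡ true) → (c ∧ d) ≡ true → (c ∧ e) ≡ true
    guarded {true} d⇒e = d⇒e

  edgeCount-false : edgeCount (λ _ _ → false) ≡ 0
  edgeCount-false = sum-map-zero (λ x → tally-false (λ y → ∧-zeroʳ (toℕ x <ᵇ toℕ y)) (allFin n)) (allFin n)

  edgeCount-∨ : {E F : Fin n → Fin n → Bool} → (∀ x y → E x y ≡ true → F x y ≡ false) →
                edgeCount (λ x y → E x y ∨ F x y) ≡ edgeCount E + edgeCount F
  edgeCount-∨ {E} {F} disjoint = trans (cong sum (map-cong row (allFin n))) (sum-map-+ _ _ (allFin n))
    where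
    guarded : ∀ {x y} (c : Bool) → (c ∧ E x y) ≡ true → (c ∧ F x y) ≡ false
    guarded {x} {y} true  = disjoint x y
    guarded         false = λ _ → refl
    row : ∀ x → count (λ y → (toℕ x <ᵇ toℕ y) ∧ (E x y ∨ F x y)) ≡
                count (λ y → (toℕ x <ᵇ toℕ y) ∧ E x y) + count (λ y → (toℕ x <ᵇ toℕ y) ∧ F x y)
    row x = trans (count-cong (λ y → ∧-distribˡ-∨ (toℕ x <ᵇ toℕ y) (E x y) (F x y)))
                  (count-∨-disjoint {f = λ y → (toℕ x <ᵇ toℕ y) ∧ E x y}
                                    {g = λ y → (toℕ x <ᵇ toℕ y) ∧ F x y}
                                    (λ y → guarded {x} {y} (toℕ x <ᵇ toℕ y)))

  isPair : Fin n × Fin n → Fin n → Fin n → Bool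
  isPair (a , b) x y = (x ≡ᵇ a ∧ y ≡ᵇ b) ∨ (x ≡ᵇ b ∧ y ≡ᵇ a)

  isPair-true : ∀ {a b x y} → isPair (a , b) x y ≡ true → (x ≡ a × y ≡ b) ⊎ (x ≡ b × y ≡ a)
  isPair-true {a} {b} {x} {y} e with x ≟ a | y ≟ b | x ≟ b | y ≟ a | e
  ... | yes x≡a | yes y≡b | _       | _       | _  = inj₁ (x≡a , y≡b)
  ... | _       | _       | yes x≡b | yes y≡a | _  = inj₂ (x≡b , y≡a)
  ... | no _    | _       | no _    | _       | ()
  ... | no _    | _       | yes _   | no _    | ()
  ... | yes _   | no _    | no _    | _       | ()
  ... | yes _   | no _    | yes _   | no _    | ()

  edgeCount-pair< : ∀ {a b} → toℕ a < toℕ b → edgeCount (isPair (a , b)) ≡ 1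
  edgeCount-pair< {a} {b} a<b = trans (cong sum (map-cong row (allFin n))) (count-≡ᵇ a)
    where
    rowPred : Fin n → Fin n → Bool
    rowPred x y = (toℕ x <ᵇ toℕ y) ∧ isPair (a , b) x y
    only-b : ∀ y → rowPred a y ≡ true → y ≡ b
    only-b y e with isPair-true {a = a} {b = b} {x = a} {y = y} (∧-elimʳ e)
    ... | inj₁ (_ , y≡b) = y≡b
    ... | inj₂ (a≡b , _) = contradiction a<b (<-irrefl (cong toℕ a≡b))
    at-b : rowPred a b ≡ true
    at-b rewrite <⇒<ᵇ≡true a<b | ≡ᵇ-refl a | ≡ᵇ-refl b = refl
    row-other : ∀ {x} → x ≢ a → count (rowPred x) ≡ 0
    row-other {x} x≢a = tally-false none (allFin n)
      where
      none : ∀ y → rowPred x y ≡ false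
      none y with toℕ x <ᵇ toℕ y in x<y | isPair (a , b) x y in pair
      ... | false | _     = refl
      ... | true  | false = refl
      ... | true  | true with isPair-true {a = a} {b = b} {x = x} {y = y} pair
      ...   | inj₁ (x≡a , _)     = contradiction x≡a x≢a
      ...   | inj₂ (refl , refl) = contradiction (<ᵇ≡true⇒< x<y) (<-asym a<b)
    row : ∀ x → count (rowPred x) ≡ (if x ≡ᵇ a then 1 else 0)
    row x = by-cases (x ≟ a)
      where
      by-cases : Dec (x ≡ a) → count (rowPred x) ≡ (if x ≡ᵇ a then 1 else 0)
      by-cases (yes refl) = trans (count-single at-b only-b) (cong (λ c → if c then 1 else 0) (sym (≡ᵇ-refl a)))
      by-cases (no x≢a)   = trans (row-other x≢a) (cong (λ c → if c then 1 else 0) (sym (≢⇒≡ᵇ-false x≢a)))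

  edgeCount-pair : ∀ {a b} → a ≢ b → edgeCount (isPair (a , b)) ≡ 1
  edgeCount-pair {a} {b} a≢b with <-cmp (toℕ a) (toℕ b)
  ... | tri< a<b _ _ = edgeCount-pair< a<b
  ... | tri≈ _ a≡b _ = contradiction (toℕ-injective a≡b) a≢b
  ... | tri> _ _ b<a = trans (edgeCount-cong (λ x y → ∨-comm (x ≡ᵇ a ∧ y ≡ᵇ b) _)) (edgeCount-pair< b<a)

  SameEdge : Fin n × Fin n → Fin n × Fin n → Set
  SameEdge (a , b) (c , d) = (a ≡ c × b ≡ d) ⊎ (a ≡ d × b ≡ c)

  edgesOf : List (Fin n × Fin n) → Fin n → Fin n → Bool
  edgesOf es x y = any (λ e → isPair e x y) es

  edgeCount-edgesOf : ∀ es → All (λ e → proj₁ e ≢ proj₂ e) es → AllPairs (λ e f → ¬ SameEdge e f) es →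
                      edgeCount (edgesOf es) ≡ length es
  edgeCount-edgesOf []               []                []                = edgeCount-false
  edgeCount-edgesOf ((a , b) ∷ es) (loopless ∷ rest) (new ∷ distinct) =
    trans (edgeCount-∨ disjoint) (cong₂ _+_ (edgeCount-pair loopless) (edgeCount-edgesOf es rest distinct))
    where
    same-edge : ∀ {c d x y} → isPair (a , b) x y ≡ true → isPair (c , d) x y ≡ true → SameEdge (a , b) (c , d)
    same-edge {c} {d} {x} {y} abxy cdxy
      with isPair-true {a = a} {b = b} {x = x} {y = y} abxy | isPair-true {a = c} {b = d} {x = x} {y = y} cdxy
    ... | inj₁ (refl , refl) | inj₁ (refl , refl) = inj₁ (refl , refl)
    ... | inj₁ (refl , refl) | inj₂ (refl , refl) = inj₂ (refl , refl)
    ... | inj₂ (refl , refl) | inj₁ (refl , refl) = inj₂ (refl , refl)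
    ... | inj₂ (refl , refl) | inj₂ (refl , refl) = inj₁ (refl , refl)
    disjoint : ∀ x y → isPair (a , b) x y ≡ true → edgesOf es x y ≡ false
    disjoint x y abxy with edgesOf es x y in es-xy
    ... | false = refl
    ... | true with any-witness _ es es-xy
    ...   | (c , d) , cd∈es , cdxy = contradiction (same-edge {c} {d} {x} {y} abxy cdxy) (All.lookup new cd∈es)

  length≤edgeCount : {E : Fin n → Fin n → Bool} → (∀ x y → E x y ≡ E y x) → (∀ x → E x x ≡ false) →
                     ∀ es → All (λ e → E (proj₁ e) (proj₂ e) ≡ true) es →
                     AllPairs (λ e f → ¬ SameEdge e f) es → length es ≤ edgeCount E
  length≤edgeCount {E} E-sym E-irrefl es edges distinct = begin
    length es              ≡⟨ edgeCount-edgesOf es (All.map loopless edges) distinct ⟨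
    edgeCount (edgesOf es) ≤⟨ edgeCount-mono covered ⟩
    edgeCount E            ∎
    where
    open ≤-Reasoning
    loopless : ∀ {e} → E (proj₁ e) (proj₂ e) ≡ true → proj₁ e ≢ proj₂ e
    loopless {a , _} Eab refl = contradiction (trans (sym Eab) (E-irrefl a)) λ ()
    covered : ∀ x y → edgesOf es x y ≡ true → E x y ≡ true
    covered x y exy with any-witness _ es exy
    ... | (a , b) , ab∈es , pair with isPair-true {a = a} {b = b} {x = x} {y = y} pair
    ...   | inj₁ (refl , refl) = All.lookup edges ab∈es
    ...   | inj₂ (refl , refl) = trans (E-sym x y) (All.lookup edges ab∈es)

module _ {A : Set} where

  all-reverse : {P : A → Set} {xs : List A} → All P xs → All P (reverse xs)
  all-reverse pxs = All.tabulate (All.lookup pxs ∘ Any.reverse⁻)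

  allPairs-reverse : {R : A → A → Set} {xs : List A} → AllPairs R xs → AllPairs (flip R) (reverse xs)
  allPairs-reverse {xs = []} [] = []
  allPairs-reverse {R} {xs = x ∷ xs} (px ∷ pxs) rewrite unfold-reverse x xs =
    AllPairs.++⁺ (allPairs-reverse pxs) ([] ∷ []) (All.map (_∷ []) (all-reverse px))

  allPairs-restrict : {P : A → Set} {R S : A → A → Set} → (∀ {x y} → P x → P y → R x y → S x y) →
                      {xs : List A} → All P xs → AllPairs R xs → AllPairs S xs
  allPairs-restrict f []         []         = []
  allPairs-restrict f (px ∷ pxs) (rx ∷ rxs) =
    All.zipWith (λ (py , rxy) → f px py rxy) (pxs , rx) ∷ allPairs-restrict f pxs rxs

  allPairs-take-drop : {R : A → A → Set} (c : ℕ) {xs : List A} → AllPairs R xs →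
                       All (λ a → All (R a) (drop c xs)) (take c xs)
  allPairs-take-drop zero    _          = []
  allPairs-take-drop (suc c) []         = []
  allPairs-take-drop (suc c) (px ∷ pxs) = All.drop⁺ c px ∷ allPairs-take-drop c pxs

  chunk : ℕ → (ℓ : ℕ) → List A → Fin ℓ → List A
  chunk c (suc ℓ) xs zero    = take c xs
  chunk c (suc ℓ) xs (suc i) = chunk c ℓ (drop c xs) i

  chunk-all : {P : A → Set} (c ℓ : ℕ) {xs : List A} → All P xs → (i : Fin ℓ) → All P (chunk c ℓ xs i)
  chunk-all c (suc ℓ) pxs zero    = All.take⁺ c pxs
  chunk-all c (suc ℓ) pxs (suc i) = chunk-all c ℓ (All.drop⁺ c pxs) i

  chunk-allPairs : {R : A → A → Set} (c ℓ : ℕ) {xs : List A} → AllPairs R xs → (i : Fin ℓ) →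
                   AllPairs R (chunk c ℓ xs i)
  chunk-allPairs c (suc ℓ) rxs zero    = AllPairs.take⁺ c rxs
  chunk-allPairs c (suc ℓ) rxs (suc i) = chunk-allPairs c ℓ (AllPairs.drop⁺ c rxs) i

  chunk-length : (c ℓ : ℕ) (xs : List A) → c * ℓ ≤ length xs → (i : Fin ℓ) → length (chunk c ℓ xs i) ≡ c
  chunk-length c (suc ℓ) xs long i = go i
    where
    open ≤-Reasoning
    long′ : c + c * ℓ ≤ length xs
    long′ = ≤-trans (≤-reflexive (sym (*-suc c ℓ))) long
    go : ∀ i → length (chunk c (suc ℓ) xs i) ≡ c
    go zero    = trans (length-take c xs) (m≤n⇒m⊓n≡m (≤-trans (m≤m+n c _) long′))
    go (suc i) = chunk-length c ℓ (drop c xs) (begin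
      c * ℓ               ≡⟨ m+n∸n≡m (c * ℓ) c ⟨
      c * ℓ + c ∸ c       ≤⟨ ∸-monoˡ-≤ c (≤-trans (≤-reflexive (+-comm (c * ℓ) c)) long′) ⟩
      length xs ∸ c       ≡⟨ length-drop c xs ⟨
      length (drop c xs)  ∎) i

  chunk-cross : {R : A → A → Set} (c ℓ : ℕ) {xs : List A} → AllPairs R xs → {i j : Fin ℓ} → i F.< j →
                All (λ a → All (R a) (chunk c ℓ xs j)) (chunk c ℓ xs i)
  chunk-cross c (suc ℓ) rxs {zero}  {suc j} _         = All.map (λ ra → chunk-all c ℓ ra j) (allPairs-take-drop c rxs)
  chunk-cross c (suc ℓ) rxs {suc i} {suc j} (s≤s i<j) = chunk-cross c ℓ (AllPairs.drop⁺ c rxs) i<j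

  chunk-apart : {R : A → A → Set} → Symmetric R → (c ℓ : ℕ) {xs : List A} → AllPairs R xs →
                {i j : Fin ℓ} → i ≢ j →
                All (λ a → All (R a) (chunk c ℓ xs j)) (chunk c ℓ xs i)
  chunk-apart R-sym c ℓ rxs {i} {j} i≢j with F.<-cmp i j
  ... | tri< i<j _ _ = chunk-cross c ℓ rxs i<j
  ... | tri≈ _ i≡j _ = contradiction i≡j i≢j
  ... | tri> _ _ j<i = All.map (All.map R-sym) (All.All-swap (chunk-cross c ℓ rxs j<i))

∣∣≡count : {n : ℕ} (L : Subset n) → ∣ L ∣ ≡ count (λ x → does (x ∈? L))
∣∣≡count {zero}  Vec.[]          = refl
∣∣≡count {suc n} (true Vec.∷ L)  =
  trans (cong suc (∣∣≡count L)) (sym (count-suc {n} (λ x → does (x ∈? true Vec.∷ L))))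
∣∣≡count {suc n} (false Vec.∷ L) = trans (∣∣≡count L) (sym (count-suc {n} (λ x → does (x ∈? false Vec.∷ L))))

isLeafᵇ⇒IsLeaf : {n : ℕ} (H : Graph n) {x : Fin n} → isLeafᵇ H x ≡ true → IsLeaf H x
isLeafᵇ⇒IsLeaf H {x} e with degree H x
isLeafᵇ⇒IsLeaf H () | zero
isLeafᵇ⇒IsLeaf H e  | suc zero = refl
isLeafᵇ⇒IsLeaf H () | suc (suc _)

IsLeaf⇒isLeafᵇ : {n : ℕ} (H : Graph n) {x : Fin n} → IsLeaf H x → isLeafᵇ H x ≡ true
IsLeaf⇒isLeafᵇ H {x} leaf with degree H x
IsLeaf⇒isLeafᵇ H refl | .1 = refl

module Relocation {n : ℕ} (G T : Graph n) (L : Subset n)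
  (L-degree : ∀ v → v ∈ L → 2 ≤ degree G v) (T⊆G : T ⊆G G) (T-tree : IsTree T)
  (L-leaves : ∀ v → v ∈ L → IsLeaf T v) where

  parent : Fin n → Fin n
  parent x = choose (adj T x) x

  parent-adj : ∀ {x} → IsLeaf T x → adj T x (parent x) ≡ true
  parent-adj {x} leaf = choose-spec (adj T x) x (≤-reflexive (sym leaf))

  parent-unique : ∀ {x y} → IsLeaf T x → adj T x y ≡ true → y ≡ parent x
  parent-unique leaf xy = count≤1⇒unique (≤-reflexive leaf) xy (parent-adj leaf)

  newParent : Fin n → Fin n
  newParent x = choose (λ y → adj G x y ∧ not (y ≡ᵇ parent x)) x

  newParent-spec : ∀ {x} → x ∈ L → (adj G x (newParent x) ∧ not (newParent x ≡ᵇ parent x)) ≡ true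
  newParent-spec {x} x∈L with count≥2⇒other (L-degree x x∈L) (parent x)
  ... | y , xy , y≢p =
    choose-spec _ x (count-positive {f = λ z → adj G x z ∧ not (z ≡ᵇ parent x)} {a = y} candidate)
    where
    candidate : (adj G x y ∧ not (y ≡ᵇ parent x)) ≡ true
    candidate rewrite xy | ≢⇒≡ᵇ-false y≢p = refl

  newParent-adj : ∀ {x} → x ∈ L → adj G x (newParent x) ≡ true
  newParent-adj x∈L = ∧-elimˡ (newParent-spec x∈L)

  newParent≢parent : ∀ {x} → x ∈ L → newParent x ≢ parent x
  newParent≢parent {x} x∈L np≡p =
    contradiction (trans (sym (∧-elimʳ (newParent-spec x∈L))) (cong not (dec-true (newParent x ≟ parent x) np≡p)))
                  λ ()

  newParent≢self : ∀ {x} → x ∈ L → newParent x ≢ x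
  newParent≢self {x} x∈L np≡x =
    contradiction (trans (sym (subst (λ z → adj G x z ≡ true) np≡x (newParent-adj x∈L))) (Graph.irrefl G x)) λ ()

  -- if x and v ∈ L were adjacent leaves, T would be the single edge xv, leaving no room for newParent v
  leaf-not-adjacent-to-L : ∀ {x v} → IsLeaf T x → v ∈ L → adj T x v ≡ true → ⊥
  leaf-not-adjacent-to-L {x} {v} x-leaf v∈L xv
    with walk-within-edge v→x x→v (proj₁ T-tree v (newParent v)) (inj₁ refl)
    where
    v-leaf = L-leaves v v∈L
    v→x : ∀ y → adj T v y ≡ true → y ≡ x
    v→x y vy = trans (parent-unique v-leaf vy) (sym (parent-unique v-leaf (adj-sym T xv)))
    x→v : ∀ y → adj T x y ≡ true → y ≡ v
    x→v y xy = trans (parent-unique x-leaf xy) (sym (parent-unique x-leaf xv))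
  ... | inj₁ np≡v = newParent≢self v∈L np≡v
  ... | inj₂ np≡x = newParent≢parent v∈L (trans np≡x (parent-unique (L-leaves v v∈L) (adj-sym T xv)))

  parent∉L : ∀ {x} → x ∈ L → parent x ∉ L
  parent∉L x∈L p∈L = leaf-not-adjacent-to-L (L-leaves _ x∈L) p∈L (parent-adj (L-leaves _ x∈L))

  relocate : List (Fin n) → Graph n
  relocate []      = T
  relocate (u ∷ S) = rehang (relocate S) u (newParent u)

  Rehung : List (Fin n) → Fin n → Fin n → Set
  Rehung S x y = x ∈ₗ S × y ≡ newParent x

  -- relocate (u ∷ S) rehangs u after all of S, so u must not be the new parent of anything in S
  Admissible : List (Fin n) → Set
  Admissible = AllPairs (λ u v → u ≢ v × newParent v ≢ u)

  Apart : Fin n → Fin n → Set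
  Apart u v = u ≢ v × ¬ (newParent u ≡ v × newParent v ≡ u)

  Apart-sym : Symmetric Apart
  Apart-sym (u≢v , not-mutual) = ≢-sym u≢v , λ (npv≡u , npu≡v) → not-mutual (npu≡v , npv≡u)

  Admissible⇒Apart : ∀ {S} → Admissible S → AllPairs Apart S
  Admissible⇒Apart = AllPairs.map (λ (u≢v , npv≢u) → u≢v , λ (_ , npv≡u) → npv≢u npv≡u)

  relocate-edge : ∀ S {x y} → adj (relocate S) x y ≡ true →
                  (x ∉ₗ S × y ∉ₗ S × adj T x y ≡ true) ⊎ Rehung S x y ⊎ Rehung S y x
  relocate-edge []      xy = inj₁ ((λ ()) , (λ ()) , xy)
  relocate-edge (u ∷ S) {x} {y} xy with rehang-edge {H = relocate S} {u = u} {v = newParent u} {x = x} {y = y} xy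
  ... | inj₂ (inj₁ (refl , refl)) = inj₂ (inj₁ (here refl , refl))
  ... | inj₂ (inj₂ (refl , refl)) = inj₂ (inj₂ (here refl , refl))
  ... | inj₁ (x≢u , y≢u , xy′) with relocate-edge S xy′
  ...   | inj₁ (x∉S , y∉S , xy″)  = inj₁ (∉-∷ x≢u x∉S , ∉-∷ y≢u y∉S , xy″)
    where
    ∉-∷ : ∀ {z} → z ≢ u → z ∉ₗ S → z ∉ₗ u ∷ S
    ∉-∷ z≢u z∉S (here z≡u)  = z≢u z≡u
    ∉-∷ z≢u z∉S (there z∈S) = z∉S z∈S
  ...   | inj₂ (inj₁ (x∈S , eq)) = inj₂ (inj₁ (there x∈S , eq))
  ...   | inj₂ (inj₂ (y∈S , eq)) = inj₂ (inj₂ (there y∈S , eq))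

  relocate-away : ∀ S {x y} → x ∉ₗ S → y ∉ₗ S → adj (relocate S) x y ≡ adj T x y
  relocate-away []      _   _   = refl
  relocate-away (u ∷ S) x∉S y∉S =
    trans (rehang-away {H = relocate S} {u = u} {v = newParent u} (x∉S ∘ here) (y∉S ∘ here))
          (relocate-away S (x∉S ∘ there) (y∉S ∘ there))

  relocated-newParent : ∀ {S} → All (_∈ L) S → Admissible S → ∀ {u} → u ∈ₗ S →
                        adj (relocate S) u (newParent u) ≡ true
  relocated-newParent {u ∷ S} (u∈L ∷ _) _ (here refl) = rehang-new-edge {H = relocate S} (newParent≢self u∈L)
  relocated-newParent {v ∷ S} (_ ∷ S⊆L) (fresh ∷ admissible) (there u∈S) with All.lookup fresh u∈S
  ... | v≢u , npu≢v =
    trans (rehang-away {H = relocate S} {u = v} {v = newParent v} (≢-sym v≢u) npu≢v)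
          (relocated-newParent S⊆L admissible u∈S)

  unrelocated-¬newParent : ∀ S {u} → u ∈ L → All (Apart u) S → adj (relocate S) u (newParent u) ≡ false
  unrelocated-¬newParent S {u} u∈L apart = ¬-not (λ u-np → impossible (relocate-edge S u-np))
    where
    impossible : (u ∉ₗ S × newParent u ∉ₗ S × adj T u (newParent u) ≡ true) ⊎
                 Rehung S u (newParent u) ⊎ Rehung S (newParent u) u → ⊥
    impossible (inj₁ (_ , _ , u-np))          = newParent≢parent u∈L (parent-unique (L-leaves u u∈L) u-np)
    impossible (inj₂ (inj₁ (u∈S , _)))        = proj₁ (All.lookup apart u∈S) refl
    impossible (inj₂ (inj₂ (np∈S , u≡npnp)))  = proj₂ (All.lookup apart np∈S) (refl , sym u≡npnp)

  relocated-¬parent : ∀ {S} → All (_∈ L) S → ∀ {u} → u ∈ₗ S → adj (relocate S) u (parent u) ≡ false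
  relocated-¬parent {S} S⊆L {u} u∈S = ¬-not (λ u-p → impossible (relocate-edge S u-p))
    where
    u∈L = All.lookup S⊆L u∈S
    impossible : (u ∉ₗ S × parent u ∉ₗ S × adj T u (parent u) ≡ true) ⊎
                 Rehung S u (parent u) ⊎ Rehung S (parent u) u → ⊥
    impossible (inj₁ (u∉S , _ , _))     = u∉S u∈S
    impossible (inj₂ (inj₁ (_ , p≡np))) = newParent≢parent u∈L (sym p≡np)
    impossible (inj₂ (inj₂ (p∈S , _)))  = parent∉L u∈L (All.lookup S⊆L p∈S)

  unrelocated-parent : ∀ {S} → All (_∈ L) S → ∀ {u} → IsLeaf T u → u ∉ₗ S →
                       adj (relocate S) u (parent u) ≡ true
  unrelocated-parent {S} S⊆L {u} u-leaf u∉S =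
    trans (relocate-away S u∉S (λ p∈S → leaf-not-adjacent-to-L u-leaf (All.lookup S⊆L p∈S) (parent-adj u-leaf)))
          (parent-adj u-leaf)

  relocate-⊆G : ∀ S → All (_∈ L) S → relocate S ⊆G G
  relocate-⊆G S S⊆L x y xy with relocate-edge S xy
  ... | inj₁ (_ , _ , xy′)           = T⊆G x y xy′
  ... | inj₂ (inj₁ (x∈S , refl))     = newParent-adj (All.lookup S⊆L x∈S)
  ... | inj₂ (inj₂ (y∈S , refl))     = adj-sym G (newParent-adj (All.lookup S⊆L y∈S))

  relocate-isTree : ∀ S → All (_∈ L) S → Admissible S → IsTree (relocate S)
  relocate-isTree []      _            _                    = T-tree
  relocate-isTree (u ∷ S) (u∈L ∷ S⊆L) (fresh ∷ admissible) =
    rehang-isTree (newParent≢self u∈L) only-parent (relocate-isTree S S⊆L admissible)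
    where
    only-parent : ∀ y → adj (relocate S) u y ≡ true → y ≡ parent u
    only-parent y uy with relocate-edge S uy
    ... | inj₁ (_ , _ , uy′)       = parent-unique (L-leaves u u∈L) uy′
    ... | inj₂ (inj₁ (u∈S , _))    = contradiction refl (proj₁ (All.lookup fresh u∈S))
    ... | inj₂ (inj₂ (y∈S , u≡np)) = contradiction (sym u≡np) (proj₂ (All.lookup fresh y∈S))

  relocate-internal : ∀ S → All (_∈ L) S → ∀ {x} → IsInternal T x →
                      2 ≤ count (λ y → adj T x y ∧ not (lookup L y)) → IsInternal (relocate S) x
  relocate-internal S S⊆L {x} x-internal spread x-leaf = 1+n≰n {1} (begin
    2                                              ≤⟨ spread ⟩
    count (λ y → adj T x y ∧ not (lookup L y))     ≤⟨ count-mono kept ⟩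
    degree (relocate S) x                          ≡⟨ x-leaf ⟩
    1                                              ∎)
    where
    open ≤-Reasoning
    x∉S : x ∉ₗ S
    x∉S x∈S = x-internal (L-leaves x (All.lookup S⊆L x∈S))
    kept : ∀ y → (adj T x y ∧ not (lookup L y)) ≡ true → adj (relocate S) x y ≡ true
    kept y e = trans (relocate-away S x∉S y∉S) (∧-elimˡ e)
      where
      y∉S : y ∉ₗ S
      y∉S y∈S = contradiction (trans (sym (∧-elimʳ e)) (cong not ([]=⇒lookup (All.lookup S⊆L y∈S)))) λ ()

  isTarget : List (Fin n) → Fin n → Bool
  isTarget S x = any (λ v → x ≡ᵇ newParent v) S

  relocate-leaf : ∀ S → All (_∈ L) S → Admissible S → ∀ {x} → IsLeaf T x →
                  ¬ Any.Any (λ v → newParent v ≡ x) S → IsLeaf (relocate S) x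
  relocate-leaf S S⊆L admissible {x} x-leaf untargeted with Any.any? (x ≟_) S
  ... | yes x∈S = count-single (relocated-newParent S⊆L admissible x∈S) only-newParent
    where
    only-newParent : ∀ y → adj (relocate S) x y ≡ true → y ≡ newParent x
    only-newParent y xy with relocate-edge S xy
    ... | inj₁ (x∉S , _ , _)       = contradiction x∈S x∉S
    ... | inj₂ (inj₁ (_ , y≡np))   = y≡np
    ... | inj₂ (inj₂ (y∈S , x≡np)) = contradiction (Any.map (λ { refl → sym x≡np }) y∈S) untargeted
  ... | no x∉S = count-single (unrelocated-parent S⊆L x-leaf x∉S) only-parent
    where
    only-parent : ∀ y → adj (relocate S) x y ≡ true → y ≡ parent x
    only-parent y xy with relocate-edge S xy
    ... | inj₁ (_ , _ , xy′)       = parent-unique x-leaf xy′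
    ... | inj₂ (inj₁ (x∈S , _))    = contradiction x∈S x∉S
    ... | inj₂ (inj₂ (y∈S , x≡np)) = contradiction (Any.map (λ { refl → sym x≡np }) y∈S) untargeted

  relocate-numLeaves : ∀ S → All (_∈ L) S → Admissible S → numLeaves T ≤ numLeaves (relocate S) + length S
  relocate-numLeaves S S⊆L admissible = begin
    numLeaves T                                                  ≤⟨ count-mono kept-or-targeted ⟩
    count (λ x → isLeafᵇ (relocate S) x ∨ isTarget S x)          ≤⟨ count-∨ (isLeafᵇ (relocate S)) (isTarget S) ⟩
    numLeaves (relocate S) + count (isTarget S)                  ≤⟨ +-monoʳ-≤ _ (count-image newParent S) ⟩
    numLeaves (relocate S) + length S                            ∎
    where
    open ≤-Reasoning
    kept-or-targeted : ∀ x → isLeafᵇ T x ≡ true → (isLeafᵇ (relocate S) x ∨ isTarget S x) ≡ true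
    kept-or-targeted x x-leaf with Any.any? (λ v → newParent v ≟ x) S
    ... | yes targeted =
      trans (cong (isLeafᵇ (relocate S) x ∨_)
                  (any-intro (Any.map (λ np≡x → dec-true (x ≟ _) (sym np≡x)) targeted)))
            (∨-zeroʳ _)
    ... | no untargeted
      rewrite IsLeaf⇒isLeafᵇ (relocate S) (relocate-leaf S S⊆L admissible (isLeafᵇ⇒IsLeaf T x-leaf) untargeted) = refl

  spokes : List (Fin n) → List (Fin n × Fin n)
  spokes U = map (λ u → u , parent u) U ++ map (λ u → u , newParent u) U

  length-spokes : ∀ U → length (spokes U) ≡ length U + length U
  length-spokes U = trans (length-++ (map (λ u → u , parent u) U)) (cong₂ _+_ (length-map _ U) (length-map _ U))

  spokes-distinct : ∀ {U} → All (_∈ L) U → AllPairs Apart U → AllPairs (λ e f → ¬ SameEdge e f) (spokes U)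
  spokes-distinct U⊆L apart =
    AllPairs.++⁺ (AllPairs.map⁺ (allPairs-restrict parent-spokes U⊆L apart))
                 (AllPairs.map⁺ (AllPairs.map newParent-spokes apart))
                 (All.map⁺ (All.map (λ u∈L → All.map⁺ (All.map (mixed-spokes u∈L) U⊆L)) U⊆L))
    where
    parent-spokes : ∀ {u v} → u ∈ L → v ∈ L → Apart u v → ¬ SameEdge (u , parent u) (v , parent v)
    parent-spokes _   _   (u≢v , _) (inj₁ (u≡v , _))     = u≢v u≡v
    parent-spokes u∈L v∈L _         (inj₂ (refl , _))    = parent∉L v∈L u∈L
    newParent-spokes : ∀ {u v} → Apart u v → ¬ SameEdge (u , newParent u) (v , newParent v)
    newParent-spokes (u≢v , _)        (inj₁ (u≡v , _))       = u≢v u≡v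
    newParent-spokes (_ , not-mutual) (inj₂ (u≡npv , npu≡v)) = not-mutual (npu≡v , sym u≡npv)
    mixed-spokes : ∀ {u v} → u ∈ L → v ∈ L → ¬ SameEdge (u , parent u) (v , newParent v)
    mixed-spokes u∈L _   (inj₁ (refl , pu≡npu)) = newParent≢parent u∈L (sym pu≡npu)
    mixed-spokes u∈L v∈L (inj₂ (_ , refl))      = parent∉L u∈L v∈L

  spokes-switched : ∀ {S S′} → All (_∈ L) S → All (_∈ L) S′ → Admissible S →
                    ∀ {u} → u ∈ₗ S → All (Apart u) S′ →
                    (adj (relocate S) u (parent u) , adj (relocate S′) u (parent u)) ≡ (false , true) ×
                    (adj (relocate S) u (newParent u) , adj (relocate S′) u (newParent u)) ≡ (true , false)
  spokes-switched {S} {S′} S⊆L S′⊆L S-admissible {u} u∈S u-apart-S′ =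
    cong₂ _,_ (relocated-¬parent S⊆L u∈S) (unrelocated-parent S′⊆L (L-leaves u u∈L) u∉S′) ,
    cong₂ _,_ (relocated-newParent S⊆L S-admissible u∈S) (unrelocated-¬newParent S′ u∈L u-apart-S′)
    where
    u∈L = All.lookup S⊆L u∈S
    u∉S′ : u ∉ₗ S′
    u∉S′ u∈S′ = proj₁ (All.lookup u-apart-S′ u∈S′) refl

  relocate-symDiff : ∀ A B → All (_∈ L) A → All (_∈ L) B → Admissible A → Admissible B →
                     All (λ a → All (Apart a) B) A →
                     length (A ++ B) + length (A ++ B) ≤ symDiffSize (relocate A) (relocate B)
  relocate-symDiff A B A⊆L B⊆L A-admissible B-admissible apart-AB = begin
    length (A ++ B) + length (A ++ B)      ≡⟨ length-spokes (A ++ B) ⟨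
    length (spokes (A ++ B))               ≤⟨ length≤edgeCount D-sym D-irrefl (spokes (A ++ B)) differing
                                                                (spokes-distinct (All.++⁺ A⊆L B⊆L) apart) ⟩
    symDiffSize (relocate A) (relocate B)  ∎
    where
    open ≤-Reasoning
    D : Fin n → Fin n → Bool
    D x y = adj (relocate A) x y xor adj (relocate B) x y
    D-sym : ∀ x y → D x y ≡ D y x
    D-sym x y = cong₂ _xor_ (Graph.sym (relocate A) x y) (Graph.sym (relocate B) x y)
    D-irrefl : ∀ x → D x x ≡ false
    D-irrefl x = cong₂ _xor_ (Graph.irrefl (relocate A) x) (Graph.irrefl (relocate B) x)
    apart : AllPairs Apart (A ++ B)
    apart = AllPairs.++⁺ (Admissible⇒Apart A-admissible) (Admissible⇒Apart B-admissible) apart-AB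
    both-spokes-differ : ∀ {u} → u ∈ₗ A ++ B → D u (parent u) ≡ true × D u (newParent u) ≡ true
    both-spokes-differ u∈A++B with ∈-++⁻ A u∈A++B
    ... | inj₁ u∈A with spokes-switched A⊆L B⊆L A-admissible u∈A (All.lookup apart-AB u∈A)
    ...   | parent-spoke , newParent-spoke = cong (uncurry _xor_) parent-spoke , cong (uncurry _xor_) newParent-spoke
    both-spokes-differ u∈A++B | inj₂ u∈B with spokes-switched B⊆L A⊆L B-admissible u∈B u-apart-A
      where
      u-apart-A = All.tabulate (λ a∈A → Apart-sym (All.lookup (All.lookup apart-AB a∈A) u∈B))
    ... | parent-spoke , newParent-spoke =
      cong (uncurry (flip _xor_)) parent-spoke , cong (uncurry (flip _xor_)) newParent-spoke
    differing : All (λ e → D (proj₁ e) (proj₂ e) ≡ true) (spokes (A ++ B))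
    differing = All.++⁺ (All.map⁺ (All.tabulate (proj₁ ∘ both-spokes-differ)))
                        (All.map⁺ (All.tabulate (proj₂ ∘ both-spokes-differ)))

  UpArc : Fin n → Set
  UpArc x = newParent x ∈ L → x F.< newParent x

  UpArc? : Decidable UpArc
  UpArc? x = (newParent x ∈? L) →-dec (x F.<? newParent x)

  -- a list in increasing index order is admissible for vertices whose new parent lies higher,
  -- one in decreasing order for the others
  admissible-list : ∀ m → m + m ≤ ∣ L ∣ → ∃[ xs ] All (_∈ L) xs × Admissible xs × m ≤ length xs
  admissible-list m 2m≤∣L∣ = pick (m ≤? length ups)
    where
    members = filter (_∈? L) (allFin n)
    members⊆L : All (_∈ L) members
    members⊆L = All.all-filter (_∈? L) (allFin n)
    members-sorted : AllPairs F._<_ members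
    members-sorted = AllPairs.filter⁺ (_∈? L) (AllPairs.tabulate⁺-< id)
    ups = filter UpArc? members
    downs = filter (¬? ∘ UpArc?) members
    ups-admissible : Admissible ups
    ups-admissible = allPairs-restrict up-order
      (All.zip (All.filter⁺ UpArc? members⊆L , All.all-filter UpArc? members)) (AllPairs.filter⁺ UpArc? members-sorted)
      where
      up-order : ∀ {u v} → u ∈ L × UpArc u → v ∈ L × UpArc v → u F.< v → u ≢ v × newParent v ≢ u
      up-order {u} {v} (u∈L , _) (_ , v-up) u<v =
        (λ u≡v → F.<-irrefl u≡v u<v) ,
        (λ npv≡u → F.<-asym u<v (subst (v F.<_) npv≡u (v-up (subst (_∈ L) (sym npv≡u) u∈L))))
    downs-admissible : Admissible (reverse downs)
    downs-admissible = allPairs-reverse (allPairs-restrict down-order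
      (All.zip (All.filter⁺ (¬? ∘ UpArc?) members⊆L , All.all-filter (¬? ∘ UpArc?) members))
      (AllPairs.filter⁺ (¬? ∘ UpArc?) members-sorted))
      where
      down-order : ∀ {u v} → u ∈ L × ¬ UpArc u → v ∈ L × ¬ UpArc v → u F.< v → v ≢ u × newParent u ≢ v
      down-order {u} {v} (_ , u-down) _ u<v =
        (λ v≡u → F.<-irrefl (sym v≡u) u<v) , (λ npu≡v → u-down (λ _ → subst (u F.<_) (sym npu≡v) u<v))
    ups+downs : length ups + length downs ≡ ∣ L ∣
    ups+downs = trans (length-filter-¬ UpArc? members)
                      (trans (length-filter≡tally (_∈? L) (allFin n)) (sym (∣∣≡count L)))
    pick : Dec (m ≤ length ups) → ∃[ xs ] All (_∈ L) xs × Admissible xs × m ≤ length xs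
    pick (yes m≤ups) = ups , All.filter⁺ UpArc? members⊆L , ups-admissible , m≤ups
    pick (no m≰ups)  =
      reverse downs , all-reverse (All.filter⁺ (¬? ∘ UpArc?) members⊆L) , downs-admissible ,
      subst (m ≤_) (sym (length-reverse downs))
        (+-cancelˡ-≤ m m _ (≤-trans (≤-trans 2m≤∣L∣ (≤-reflexive (sym ups+downs)))
                                    (+-monoˡ-≤ _ (<⇒≤ (≰⇒> m≰ups)))))

  record Blocks (c ℓ : ℕ) : Set where
    field
      block            : Fin ℓ → List (Fin n)
      block⊆L          : ∀ i → All (_∈ L) (block i)
      block-admissible : ∀ i → Admissible (block i)
      block-length     : ∀ i → length (block i) ≡ c
      blocks-apart     : ∀ {i j} → i ≢ j → All (λ a → All (Apart a) (block j)) (block i)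

  blocks : ∀ c ℓ → 2 * c * ℓ ≤ ∣ L ∣ → Blocks c ℓ
  blocks c ℓ large = record
    { block            = chunk c ℓ xs
    ; block⊆L          = chunk-all c ℓ xs⊆L
    ; block-admissible = chunk-allPairs c ℓ xs-admissible
    ; block-length     = chunk-length c ℓ xs xs-long
    ; blocks-apart     = chunk-apart Apart-sym c ℓ (Admissible⇒Apart xs-admissible)
    }
    where
    two-c*ℓ : 2 * c * ℓ ≡ c * ℓ + c * ℓ
    two-c*ℓ = trans (*-assoc 2 c ℓ) (cong (c * ℓ +_) (+-identityʳ (c * ℓ)))
    listing = admissible-list (c * ℓ) (subst (_≤ ∣ L ∣) two-c*ℓ large)
    xs = proj₁ listing
    xs⊆L = proj₁ (proj₂ listing)
    xs-admissible = proj₁ (proj₂ (proj₂ listing))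
    xs-long = proj₂ (proj₂ (proj₂ listing))

k≤4⌈k/4⌉ : ∀ k → k ≤ (ceil4 k + ceil4 k) + (ceil4 k + ceil4 k)
k≤4⌈k/4⌉ k = +-cancelˡ-≤ 3 k _ (begin
  3 + k                         ≡⟨ +-comm 3 k ⟩
  k + 3                         ≡⟨ m≡m%n+[m/n]*n (k + 3) 4 ⟩
  (k + 3) % 4 + c * 4           ≤⟨ +-monoˡ-≤ (c * 4) (s≤s⁻¹ (m%n<n (k + 3) 4)) ⟩
  3 + c * 4                     ≡⟨ cong (3 +_) four-c ⟩
  3 + ((c + c) + (c + c))       ∎)
  where
  open ≤-Reasoning
  c = ceil4 k
  four-c : c * 4 ≡ (c + c) + (c + c)
  four-c = trans (*-comm c 4)
                 (trans (cong (λ z → c + (c + (c + z))) (+-identityʳ c)) (sym (+-assoc c c (c + c))))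

lemma8 : (k ℓ : ℕ) → 1 ≤ k → 1 ≤ ℓ → {n : ℕ} → (G : Graph n) → (VNT L : Subset n) →
    (∀ v → v ∈ L → 2 ≤ degree G v) →
    2 * ceil4 k * ℓ ≤ ∣ L ∣ →
    (T : Graph n) → IsSpanningTree G T →
    (∀ v → v ∈ VNT → IsInternal T v) →
    (∀ v → v ∈ L → IsLeaf T v) →
    (∀ v → v ∈ VNT → 2 ≤ count (λ w → adj T v w ∧ not (lookup L w))) →
    Σ (Fin ℓ → Graph n) λ Ts →
      (∀ i → IsSpanningTree G (Ts i)) ×
      (∀ i j → i ≢ j → k ≤ symDiffSize (Ts i) (Ts j)) ×
      (∀ i v → v ∈ VNT → IsInternal (Ts i) v) ×
      (∀ i → numLeaves T ∸ ceil4 k ≤ numLeaves (Ts i))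
lemma8 k ℓ _ _ G VNT L L-degree L-large T (T⊆G , T-tree) VNT-internal L-leaves VNT-spread =
  relocate ∘ block , spanning , diverse , internal , leafy
  where
  open Relocation G T L L-degree T⊆G T-tree L-leaves
  c = ceil4 k
  open Blocks (blocks c ℓ L-large)
  open ≤-Reasoning
  spanning : ∀ i → IsSpanningTree G (relocate (block i))
  spanning i = relocate-⊆G (block i) (block⊆L i) ,
               relocate-isTree (block i) (block⊆L i) (block-admissible i)
  diverse : ∀ i j → i ≢ j → k ≤ symDiffSize (relocate (block i)) (relocate (block j))
  diverse i j i≢j = begin
    k                  ≤⟨ k≤4⌈k/4⌉ k ⟩
    (c + c) + (c + c)  ≡⟨ cong (λ m → m + m) two-blocks ⟨
    length (block i ++ block j) + length (block i ++ block j)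
      ≤⟨ relocate-symDiff (block i) (block j) (block⊆L i) (block⊆L j)
                          (block-admissible i) (block-admissible j) (blocks-apart i≢j) ⟩
    symDiffSize (relocate (block i)) (relocate (block j)) ∎
    where
    two-blocks = trans (length-++ (block i)) (cong₂ _+_ (block-length i) (block-length j))
  internal : ∀ i v → v ∈ VNT → IsInternal (relocate (block i)) v
  internal i v v∈VNT = relocate-internal (block i) (block⊆L i) (VNT-internal v v∈VNT) (VNT-spread v v∈VNT)
  leafy : ∀ i → numLeaves T ∸ c ≤ numLeaves (relocate (block i))
  leafy i = m≤n+o⇒m∸n≤o (numLeaves T) c (begin
    numLeaves T
      ≤⟨ relocate-numLeaves (block i) (block⊆L i) (block-admissible i) ⟩
    numLeaves (relocate (block i)) + length (block i)
      ≡⟨ trans (cong (numLeaves (relocate (block i)) +_) (block-length i)) (+-comm _ c) ⟩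
    c + numLeaves (relocate (block i)) ∎)
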